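{- Let $k\ge1$ and $t_1,\dots,t_k$ be positive integers, and let $I=\{1,\dots,k\}$. Define the relative greatest common divisors $x_J$ for nonempty $J\subseteq I$ recursively by $x_I=\gcd(t_1,\dots,t_k)$ and, for nonempty $J=\{i_1,\dots,i_{|J|}\}\subseteq I$, $$x_J=\frac{\gcd(t_{i_1},\dots,t_{i_{|J|}})}{\prod_{J\subsetneq J'\subseteq I}x_{J'}}.$$ If $J,K\subseteq I$ are nonempty with $J\not\subseteq K$ and $K\not\subseteq J$, then $\gcd(x_J,x_K)=1$. -}

module Defs where

open import Data.Nat using (ℕ; zero; suc; _∸_)
open import Data.Nat.DivMod using (_/_)
open import Data.Nat.GCD using (gcd)
open import Data.Bool using (Bool; true; false)
open import Data.Fin using (Fin)
open import Data.Fin.Subset using (Subset; _∈_; _⊂_; ∣_∣)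
open import Data.Fin.Subset.Properties using (_∈?_; _⊂?_)
open import Data.List using (List; []; _∷_; map; _++_; filter; foldr; allFin)
open import Data.Nat.ListAction using (product)
open import Data.Vec using (Vec; []; _∷_)

allSubsets : (n : ℕ) → List (Subset n)
allSubsets zero    = [] ∷ []
allSubsets (suc n) = map (true ∷_) (allSubsets n) ++ map (false ∷_) (allSubsets n)

elems : {k : ℕ} → Subset k → List (Fin k)
elems {k} J = filter (_∈? J) (allFin k)

-- gcd(t_{i_1}, ..., t_{i_|J|}) for J = {i_1,...,i_|J|}  (gcd of the empty family is 0).
gcdOver : {k : ℕ} → (Fin k → ℕ) → Subset k → ℕ
gcdOver t J = foldr (λ i g → gcd (t i) g) 0 (elems J)

strictSupersets : {k : ℕ} → Subset k → List (Subset k)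
strictSupersets {k} J = filter (J ⊂?_) (allSubsets k)

-- Natural-number division; the divisions in the paper are exact with
-- positive divisors, so the convention for divisor 0 is irrelevant.
_div_ : ℕ → ℕ → ℕ
m div zero    = 0
m div (suc n) = m / suc n

-- Recursion on fuel ≥ k ∸ ∣J∣ (strict supersets have strictly less co-size).
relGcdAux : {k : ℕ} → (Fin k → ℕ) → ℕ → Subset k → ℕ
relGcdAux t zero    J = gcdOver t J
relGcdAux t (suc f) J =
  gcdOver t J div product (map (relGcdAux t f) (strictSupersets J))

relGcd : {k : ℕ} → (Fin k → ℕ) → Subset k → ℕ
relGcd {k} t J = relGcdAux t (k ∸ ∣ J ∣) J

module Submission where

-- Fix a prime p, write e i for the exponent of p in t i, and call
-- S m = {i : m < e i} the level set at height m; level sets shrink as m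
-- grows.  Counting heights below a bound M for all exponents,
--   * the exponent of p in gcd(t i : i ∈ J) is min_{i∈J} e i, the number
--     of heights m with J ⊆ S m;
--   * the exponent of p in x_J is the number of heights m with S m = J.
-- The second claim follows from the first by induction along the recursive
-- definition: the product of the x_J' over strict supersets J' of J has
-- exponent #{m : J ⊊ S m} (every subset occurs exactly once in the list of
-- all subsets), which never exceeds the exponent of the gcd, so the
-- division defining x_J is exact and subtracts exponents.
-- A prime dividing x_J and x_K thus makes J and K level sets of the same
-- nested family, hence comparable; so incomparable J, K give coprime x_J, x_K.

open import Defs
open import Data.Nat using (ℕ; _≤_; NonZero)
open import Data.Nat.GCD using (gcd)
open import Data.Fin using (Fin)
open import Data.Fin.Subset using (Subset; _⊆_; Nonempty)
open import Relation.Nullary using (¬_)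
open import Relation.Binary.PropositionalEquality using (_≡_)

open import Data.Bool using (true; false) renaming (_≟_ to _≟ᵇ_)
open import Data.Empty using (⊥)
open import Data.Fin.Subset using (_∈_; _⊂_; ∣_∣)
open import Data.Fin.Subset.Properties
  using (_∈?_; _⊆?_; _⊂?_; ⊆-antisym; ⊂-irref; p⊂q⇒∣p∣<∣q∣; ∣p∣≤n)
open import Data.List using (List; []; _∷_; map; filter; foldr; allFin; _++_)
open import Data.List.Properties using (map-++)
open import Data.List.Membership.Propositional using () renaming (_∈_ to _∈ˡ_)
open import Data.List.Membership.Propositional.Properties using (∈-allFin; ∈-filter⁺; ∈-filter⁻)
open import Data.List.Relation.Unary.Any using (here; there)
open import Data.List.Relation.Unary.All using (_∷_)
open import Data.Nat.Base
open import Data.Nat.Properties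
open import Data.Nat.Divisibility
open import Data.Nat.DivMod using (m/n*n≡m)
open import Data.Nat.Coprimality using (Coprime; coprime⇒gcd≡1)
open import Data.Nat.GCD using (gcd[m,n]∣m; gcd[m,n]∣n; gcd-greatest; gcd-identityʳ)
open import Data.Nat.Induction using (<-wellFounded)
open import Data.Nat.ListAction using (sum; product)
open import Data.Nat.ListAction.Properties using (sum-++)
open import Data.Nat.Primality using (Prime; prime[2]; prime⇒nonZero; prime⇒nonTrivial; euclidsLemma)
open import Data.Nat.Primality.Factorisation using (factorise)
open import Data.Product using (∃; _×_; _,_; proj₁; proj₂)
open import Data.Sum using (inj₁; inj₂)
open import Data.Vec using ([]; _∷_; tabulate)
open import Data.Vec.Properties using (≡-dec; ∷-injective; lookup∘tabulate; []=⇒lookup; lookup⇒[]=)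
open import Function using (_∘_)
open import Induction.WellFounded using (Acc; acc)
open import Relation.Binary.Definitions using (DecidableEquality)
open import Relation.Binary.PropositionalEquality
  using (refl; sym; trans; cong; cong₂; subst; subst₂; _≢_; module ≡-Reasoning)
open import Relation.Nullary using (Dec; yes; no; does; contradiction)
open import Relation.Nullary.Decidable using (dec-true)
open import Relation.Unary using (Decidable)
import Algebra.Properties.CommutativeSemigroup as CommSemigroupProperties

open CommSemigroupProperties +-commutativeSemigroup using () renaming (interchange to +-interchange)
open CommSemigroupProperties *-commutativeSemigroup using () renaming (interchange to *-interchange)

^-∣ : ∀ p {m n} → m ≤ n → p ^ m ∣ p ^ n
^-∣ p {m} {n} m≤n = divides (p ^ (n ∸ m)) (begin
  p ^ n               ≡⟨ cong (p ^_) (m+[n∸m]≡n m≤n) ⟨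
  p ^ (m + (n ∸ m))   ≡⟨ ^-distribˡ-+-* p m (n ∸ m) ⟩
  p ^ m * p ^ (n ∸ m) ≡⟨ *-comm (p ^ m) (p ^ (n ∸ m)) ⟩
  p ^ (n ∸ m) * p ^ m ∎)
  where open ≡-Reasoning

cofactor-< : ∀ {n q p} → 0 < n → n ≡ q * p → 1 < p → 0 < q × q < n
cofactor-< {q = zero}  n>0 refl _   = contradiction n>0 (λ ())
cofactor-< {q = suc q} _   refl 1<p = z<s , m<m*n (suc q) _ 1<p

record IsVal (p n e : ℕ) : Set where
  constructor val
  field
    pow∣ : p ^ e ∣ n
    pow∤ : ¬ (p ^ suc e ∣ n)

-- Every power divides 0, so only positive numbers have a valuation.
val⇒pos : ∀ {p n e} → IsVal p n e → 0 < n
val⇒pos {n = zero}  (val _ pow∤) = contradiction (_ ∣0) pow∤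
val⇒pos {n = suc _} _            = z<s

module Valuation {p : ℕ} (pp : Prime p) where

  private instance
    p≢0 : NonZero p
    p≢0 = prime⇒nonZero pp

  1<p : 1 < p
  1<p = nonTrivial⇒n>1 p {{prime⇒nonTrivial pp}}

  ∣∧∤⇒≤ : ∀ {n a b} → p ^ a ∣ n → ¬ (p ^ suc b ∣ n) → a ≤ b
  ∣∧∤⇒≤ {a = a} {b} pᵃ∣n pᵇ⁺¹∤n with a ≤? b
  ... | yes a≤b = a≤b
  ... | no  a≰b = contradiction (∣-trans (^-∣ p (≰⇒> a≰b)) pᵃ∣n) pᵇ⁺¹∤n

  val-unique : ∀ {n e e′} → IsVal p n e → IsVal p n e′ → e ≡ e′
  val-unique (val d nd) (val d′ nd′) = ≤-antisym (∣∧∤⇒≤ d nd′) (∣∧∤⇒≤ d′ nd)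

  val-1 : IsVal p 1 0
  val-1 = val (1∣ 1) (λ p*1∣1 → >⇒≢ 1<p (trans (sym (*-identityʳ p)) (∣1⇒≡1 p*1∣1)))

  val-p* : ∀ {n e} → IsVal p n e → IsVal p (p * n) (suc e)
  val-p* (val d nd) = val (*-monoʳ-∣ p d) (nd ∘ *-cancelˡ-∣ p)

  val-exists : ∀ n → 0 < n → ∃ (IsVal p n)
  val-exists n n>0 = go n>0 (<-wellFounded n)
    where
    go : ∀ {n} → 0 < n → Acc _<_ n → ∃ (IsVal p n)
    go {n} n>0 (acc rec) with p ∣? n
    ... | no p∤n = 0 , val (1∣ n) (p∤n ∘ subst (_∣ n) (*-identityʳ p))
    ... | yes (divides q n≡q*p) =
      let (q>0 , q<n) = cofactor-< n>0 n≡q*p 1<p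
          (e , q-val) = go q>0 (rec q<n)
      in suc e , subst (λ m → IsVal p m (suc e)) (sym (trans n≡q*p (*-comm q p))) (val-p* q-val)

  -- Exponents add under multiplication (this is where primality is used).
  val-* : ∀ {a b ea eb} → IsVal p a ea → IsVal p b eb → IsVal p (a * b) (ea + eb)
  val-* {ea = ea} {eb} (val (divides-refl a′) a∤) (val (divides-refl b′) b∤) = val pow∣ pow∤
    where
    regroup : a′ * p ^ ea * (b′ * p ^ eb) ≡ a′ * b′ * p ^ (ea + eb)
    regroup = trans (*-interchange a′ (p ^ ea) b′ (p ^ eb))
                    (cong (a′ * b′ *_) (sym (^-distribˡ-+-* p ea eb)))
    pow∣ : p ^ (ea + eb) ∣ a′ * p ^ ea * (b′ * p ^ eb)
    pow∣ = subst (p ^ (ea + eb) ∣_) (sym regroup) (n∣m*n (a′ * b′))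
    pow∤ : ¬ (p ^ suc (ea + eb) ∣ a′ * p ^ ea * (b′ * p ^ eb))
    pow∤ h with euclidsLemma a′ b′ pp
                  (*-cancelʳ-∣ (p ^ (ea + eb)) {{m^n≢0 p (ea + eb)}} (subst (p ^ suc (ea + eb) ∣_) regroup h))
    ... | inj₁ p∣a′ = a∤ (*-monoˡ-∣ (p ^ ea) p∣a′)
    ... | inj₂ p∣b′ = b∤ (*-monoˡ-∣ (p ^ eb) p∣b′)

  val-product : ∀ {A : Set} (f v : A → ℕ) xs → (∀ {x} → x ∈ˡ xs → IsVal p (f x) (v x)) →
    IsVal p (product (map f xs)) (sum (map v xs))
  val-product f v []       _     = val-1
  val-product f v (x ∷ xs) f-val = val-* (f-val (here refl)) (val-product f v xs (f-val ∘ there))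

  val-gcd : ∀ {a b ea eb} → IsVal p a ea → IsVal p b eb → IsVal p (gcd a b) (ea ⊓ eb)
  val-gcd {a} {b} {ea} {eb} (val a∣ a∤) (val b∣ b∤) = val
    (gcd-greatest (∣-trans (^-∣ p (m⊓n≤m ea eb)) a∣) (∣-trans (^-∣ p (m⊓n≤n ea eb)) b∣))
    (λ h → n≮n (ea ⊓ eb) (⊓-glb (∣∧∤⇒≤ (∣-trans h (gcd[m,n]∣m a b)) a∤)
                                (∣∧∤⇒≤ (∣-trans h (gcd[m,n]∣n a b)) b∤)))

  val-cancel : ∀ {x y e ey} → IsVal p (x * y) e → IsVal p y ey → IsVal p x (e ∸ ey)
  val-cancel {zero} xy-val _ = contradiction (val⇒pos xy-val) (λ ())
  val-cancel {x@(suc _)} {ey = ey} xy-val y-val =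
    let (ex , x-val) = val-exists x z<s
        e≡ex+ey = val-unique xy-val (val-* x-val y-val)
    in subst (IsVal p x) (sym (trans (cong (_∸ ey) e≡ex+ey) (m+n∸n≡m ex ey))) x-val

  ∣⇒1≤val : ∀ {n e} → p ∣ n → IsVal p n e → 1 ≤ e
  ∣⇒1≤val p∣n (val _ p∤) = ∣∧∤⇒≤ (subst (_∣ _) (sym (*-identityʳ p)) p∣n) p∤

  1≤val⇒∣ : ∀ {n e} → 1 ≤ e → IsVal p n e → p ∣ n
  1≤val⇒∣ 1≤e (val pᵉ∣n _) = subst (_∣ _) (*-identityʳ p) (∣-trans (^-∣ p 1≤e) pᵉ∣n)

open Valuation

primeFactor : ∀ n → 1 < n → ∃ λ p → Prime p × p ∣ n
primeFactor 1 (s≤s ())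
primeFactor n@(suc (suc _)) _ with factorise n
... | record { factors = [] ; isFactorisation = () }
... | record { factors = q ∷ qs ; isFactorisation = n≡q*∏qs ; factorsPrime = q-prime ∷ _ } =
  q , q-prime , divides (product qs) (trans n≡q*∏qs (*-comm q (product qs)))

ValLe : ℕ → ℕ → Set
ValLe a b = ∀ {p} (pp : Prime p) {ea eb} → IsVal p a ea → IsVal p b eb → ea ≤ eb

ValLe-cancel : ∀ {a b} c → 0 < c → ValLe (a * c) (b * c) → ValLe a b
ValLe-cancel c c>0 le pp {ea} {eb} a-val b-val =
  let (ec , c-val) = val-exists pp c c>0
  in +-cancelʳ-≤ ec ea eb (le pp (val-* pp a-val c-val) (val-* pp b-val c-val))

-- Divisibility criterion: a ∣ b when no prime occurs more often in a than in b.
-- Induction on a: split off a prime factor p of a, which then divides b too.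
val≤⇒∣ : ∀ {a b} → 0 < a → 0 < b → ValLe a b → a ∣ b
val≤⇒∣ {a} a>0 b>0 le = go a>0 b>0 le (<-wellFounded a)
  where
  go : ∀ {a b} → 0 < a → 0 < b → ValLe a b → Acc _<_ a → a ∣ b
  go {1} _ _ _ _ = 1∣ _
  go {a@(suc (suc _))} {b} a>0 b>0 le (acc rec) with primeFactor a (s≤s (s≤s z≤n))
  ... | p , pp , p∣a@(divides a₁ a≡a₁*p) =
    subst₂ _∣_ (sym a≡a₁*p) (sym b≡b₁*p) (*-monoˡ-∣ p a₁∣b₁)
    where
    p∣b : p ∣ b
    p∣b = let (_ , a-val) = val-exists pp a a>0
              (_ , b-val) = val-exists pp b b>0
          in 1≤val⇒∣ pp (≤-trans (∣⇒1≤val pp p∣a a-val) (le pp a-val b-val)) b-val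
    b₁ : ℕ
    b₁ = quotient p∣b
    b≡b₁*p : b ≡ b₁ * p
    b≡b₁*p = m∣n⇒n≡quotient*m p∣b
    a₁∣b₁ : a₁ ∣ b₁
    a₁∣b₁ = let (a₁>0 , a₁<a) = cofactor-< a>0 a≡a₁*p (1<p pp)
                (b₁>0 , _)    = cofactor-< b>0 b≡b₁*p (1<p pp)
            in go a₁>0 b₁>0 (ValLe-cancel p (<-trans z<s (1<p pp)) (subst₂ ValLe a≡a₁*p b≡b₁*p le)) (rec a₁<a)

div-exact : ∀ {g d} → 0 < d → d ∣ g → (g div d) * d ≡ g
div-exact {d = suc _} _ d∣g = m/n*n≡m d∣g

div-val : ∀ {g d} → 0 < d → 0 < g → ValLe d g →
  ∀ {p} (pp : Prime p) {eg ed} → IsVal p g eg → IsVal p d ed → IsVal p (g div d) (eg ∸ ed)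
div-val d>0 g>0 le pp g-val d-val =
  val-cancel pp (subst (λ n → IsVal _ n _) (sym (div-exact d>0 (val≤⇒∣ d>0 g>0 le))) g-val) d-val

noCommonPrime⇒coprime : ∀ {a b} → 0 < a → (∀ {p} → Prime p → p ∣ a → p ∣ b → ⊥) → Coprime a b
noCommonPrime⇒coprime a>0 _ {zero} (0∣a , _) = contradiction (sym (0∣⇒≡0 0∣a)) (<⇒≢ a>0)
noCommonPrime⇒coprime _   _ {1}    _         = refl
noCommonPrime⇒coprime _ noCommon {d@(suc (suc _))} (d∣a , d∣b) with primeFactor d (s≤s (s≤s z≤n))
... | p , pp , p∣d = contradiction (∣-trans p∣d d∣b) (noCommon pp (∣-trans p∣d d∣a))

𝟙 : ∀ {a} {P : Set a} → Dec P → ℕ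
𝟙 (yes _) = 1
𝟙 (no _)  = 0

𝟙-yes : ∀ {a} {P : Set a} → P → (d : Dec P) → 𝟙 d ≡ 1
𝟙-yes _ (yes _) = refl
𝟙-yes p (no ¬p) = contradiction p ¬p

𝟙-no : ∀ {a} {P : Set a} → ¬ P → (d : Dec P) → 𝟙 d ≡ 0
𝟙-no ¬p (yes p) = contradiction p ¬p
𝟙-no _  (no _)  = refl

𝟙-cong : ∀ {a b} {P : Set a} {Q : Set b} → (P → Q) → (Q → P) →
  (dp : Dec P) (dq : Dec Q) → 𝟙 dp ≡ 𝟙 dq
𝟙-cong P⇒Q _   (yes p) dq = sym (𝟙-yes (P⇒Q p) dq)
𝟙-cong _   Q⇒P (no ¬p) dq = sym (𝟙-no (¬p ∘ Q⇒P) dq)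

𝟙-pos : ∀ {a} {P : Set a} (d : Dec P) → 1 ≤ 𝟙 d → P
𝟙-pos (yes p) _ = p

does-true⇒ : ∀ {a} {P : Set a} (d : Dec P) → does d ≡ true → P
does-true⇒ (yes p) _ = p

count : ℕ → (ℕ → ℕ) → ℕ
count zero    f = 0
count (suc M) f = count M f + f M

count-cong : ∀ M {f g} → (∀ m → m < M → f m ≡ g m) → count M f ≡ count M g
count-cong zero    _   = refl
count-cong (suc M) f≗g = cong₂ _+_ (count-cong M (λ m m<M → f≗g m (m<n⇒m<1+n m<M))) (f≗g M (n<1+n M))

count-0 : ∀ M → count M (λ _ → 0) ≡ 0
count-0 zero    = refl
count-0 (suc M) = trans (+-identityʳ _) (count-0 M)

count-+ : ∀ M f g → count M (λ m → f m + g m) ≡ count M f + count M g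
count-+ zero    _ _ = refl
count-+ (suc M) f g = trans (cong (_+ (f M + g M)) (count-+ M f g))
                            (+-interchange (count M f) (count M g) (f M) (g M))

count-< : ∀ M a → count M (λ m → 𝟙 (m <? a)) ≡ M ⊓ a
count-< zero    a = refl
count-< (suc M) a with M <? a
... | yes M<a = begin
  count M (λ m → 𝟙 (m <? a)) + 1 ≡⟨ cong (_+ 1) (trans (count-< M a) (m≤n⇒m⊓n≡m (<⇒≤ M<a))) ⟩
  M + 1                          ≡⟨ +-comm M 1 ⟩
  suc M                          ≡⟨ m≤n⇒m⊓n≡m M<a ⟨
  suc M ⊓ a                      ∎
  where open ≡-Reasoning
... | no M≮a = begin
  count M (λ m → 𝟙 (m <? a)) + 0 ≡⟨ +-identityʳ _ ⟩
  count M (λ m → 𝟙 (m <? a))     ≡⟨ trans (count-< M a) (m≥n⇒m⊓n≡n (≮⇒≥ M≮a)) ⟩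
  a                              ≡⟨ m≥n⇒m⊓n≡n (m≤n⇒m≤1+n (≮⇒≥ M≮a)) ⟨
  suc M ⊓ a                      ∎
  where open ≡-Reasoning

count-pos : ∀ M f → 1 ≤ count M f → ∃ λ m → m < M × 1 ≤ f m
count-pos (suc M) f 1≤count with f M in fM≡
... | suc _ = M , n<1+n M , subst (1 ≤_) (sym fM≡) (s≤s z≤n)
... | zero  = let (m , m<M , 1≤fm) = count-pos M f (subst (1 ≤_) (+-identityʳ _) 1≤count)
              in m , m<n⇒m<1+n m<M , 1≤fm

sum-count : ∀ {A : Set} M (xs : List A) (h : A → ℕ → ℕ) →
  sum (map (λ x → count M (h x)) xs) ≡ count M (λ m → sum (map (λ x → h x m) xs))
sum-count M []       h = sym (count-0 M)
sum-count M (x ∷ xs) h = trans (cong (count M (h x) +_) (sum-count M xs h))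
                               (sym (count-+ M (h x) (λ m → sum (map (λ y → h y m) xs))))

∈⇒≤sum : ∀ {A : Set} (f : A → ℕ) {x xs} → x ∈ˡ xs → f x ≤ sum (map f xs)
∈⇒≤sum f (here refl)               = m≤m+n _ _
∈⇒≤sum f {xs = y ∷ _} (there x∈xs) = ≤-trans (∈⇒≤sum f x∈xs) (m≤n+m _ (f y))

_≟ₛ_ : ∀ {n} → DecidableEquality (Subset n)
_≟ₛ_ = ≡-dec _≟ᵇ_

occ : ∀ {n} → Subset n → List (Subset n) → ℕ
occ s Ls = sum (map (λ J → 𝟙 (s ≟ₛ J)) Ls)

occ-++ : ∀ {n} (s : Subset n) Ls Ks → occ s (Ls ++ Ks) ≡ occ s Ls + occ s Ks
occ-++ s Ls Ks = trans (cong sum (map-++ (λ J → 𝟙 (s ≟ₛ J)) Ls Ks)) (sum-++ (map (λ J → 𝟙 (s ≟ₛ J)) Ls) (map (λ J → 𝟙 (s ≟ₛ J)) Ks))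

occ-map-∷ : ∀ {n} b (s : Subset n) Ls → occ (b ∷ s) (map (b ∷_) Ls) ≡ occ s Ls
occ-map-∷ b s []       = refl
occ-map-∷ b s (J ∷ Ls) =
  cong₂ _+_ (𝟙-cong (proj₂ ∘ ∷-injective) (cong (b ∷_)) _ _) (occ-map-∷ b s Ls)

occ-map-∷-≢ : ∀ {n} {b c} (s : Subset n) Ls → b ≢ c → occ (b ∷ s) (map (c ∷_) Ls) ≡ 0
occ-map-∷-≢ s []       _   = refl
occ-map-∷-≢ s (J ∷ Ls) b≢c =
  cong₂ _+_ (𝟙-no (b≢c ∘ proj₁ ∘ ∷-injective) _) (occ-map-∷-≢ s Ls b≢c)

occ-allSubsets : ∀ {n} (s : Subset n) → occ s (allSubsets n) ≡ 1
occ-allSubsets []                = refl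
occ-allSubsets {suc n} (true ∷ s) = begin
  occ (true ∷ s) (map (true ∷_) A ++ map (false ∷_) A)       ≡⟨ occ-++ (true ∷ s) (map (true ∷_) A) (map (false ∷_) A) ⟩
  occ (true ∷ s) (map (true ∷_) A) + occ (true ∷ s) (map (false ∷_) A)
    ≡⟨ cong₂ _+_ (occ-map-∷ true s A) (occ-map-∷-≢ s A (λ ())) ⟩
  occ s A + 0                                                 ≡⟨ +-identityʳ _ ⟩
  occ s A                                                     ≡⟨ occ-allSubsets s ⟩
  1                                                           ∎
  where open ≡-Reasoning; A = allSubsets n
occ-allSubsets {suc n} (false ∷ s) = begin
  occ (false ∷ s) (map (true ∷_) A ++ map (false ∷_) A)      ≡⟨ occ-++ (false ∷ s) (map (true ∷_) A) (map (false ∷_) A) ⟩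
  occ (false ∷ s) (map (true ∷_) A) + occ (false ∷ s) (map (false ∷_) A)
    ≡⟨ cong₂ _+_ (occ-map-∷-≢ s A (λ ())) (occ-map-∷ false s A) ⟩
  occ s A                                                     ≡⟨ occ-allSubsets s ⟩
  1                                                           ∎
  where open ≡-Reasoning; A = allSubsets n

module _ {n} {P : Subset n → Set} (P? : Decidable P) where

  occ-filter-yes : ∀ {s} Ls → P s → occ s (filter P? Ls) ≡ occ s Ls
  occ-filter-yes          []       _  = refl
  occ-filter-yes {s} (J ∷ Ls) Ps with P? J
  ... | yes _  = cong (𝟙 (s ≟ₛ J) +_) (occ-filter-yes Ls Ps)
  ... | no ¬PJ = trans (occ-filter-yes Ls Ps)
                       (cong (_+ occ s Ls) (sym (𝟙-no (λ { refl → ¬PJ Ps }) (s ≟ₛ J))))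

  occ-filter-no : ∀ {s} Ls → ¬ P s → occ s (filter P? Ls) ≡ 0
  occ-filter-no          []       _   = refl
  occ-filter-no {s} (J ∷ Ls) ¬Ps with P? J
  ... | yes PJ = cong₂ _+_ (𝟙-no (λ { refl → ¬Ps PJ }) (s ≟ₛ J)) (occ-filter-no Ls ¬Ps)
  ... | no _   = occ-filter-no Ls ¬Ps

occ-strictSupersets : ∀ {k} (J S : Subset k) → occ S (strictSupersets J) ≡ 𝟙 (J ⊂? S)
occ-strictSupersets {k} J S with J ⊂? S
... | yes J⊂S = trans (occ-filter-yes (J ⊂?_) (allSubsets k) J⊂S) (occ-allSubsets S)
... | no  J⊄S = occ-filter-no (J ⊂?_) (allSubsets k) J⊄S

∈-strictSupersets⇒⊂ : ∀ {k} {J J′ : Subset k} → J′ ∈ˡ strictSupersets J → J ⊂ J′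
∈-strictSupersets⇒⊂ {k} {J} J′∈ = proj₂ (∈-filter⁻ (J ⊂?_) {xs = allSubsets k} J′∈)

⊆∧⊄⇒≡ : ∀ {k} {J S : Subset k} → J ⊆ S → ¬ J ⊂ S → S ≡ J
⊆∧⊄⇒≡ {J = J} {S} J⊆S J⊄S = ⊆-antisym S⊆J J⊆S
  where
  S⊆J : S ⊆ J
  S⊆J {x} x∈S with x ∈? J
  ... | yes x∈J = x∈J
  ... | no  x∉J = contradiction ((λ {y} → J⊆S {y}) , x , x∈S , x∉J) J⊄S

⊆-split : ∀ {k} (J S : Subset k) → 𝟙 (J ⊆? S) ≡ 𝟙 (J ⊂? S) + 𝟙 (S ≟ₛ J)
⊆-split J S with J ⊂? S | S ≟ₛ J
... | yes J⊂S | yes refl = contradiction J⊂S (⊂-irref refl)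
... | yes J⊂S | no  _    = 𝟙-yes {P = J ⊆ S} (proj₁ J⊂S) (J ⊆? S)
... | no  _   | yes refl = 𝟙-yes {P = J ⊆ J} (λ i∈J → i∈J) (J ⊆? J)
... | no  J⊄S | no  S≢J  = 𝟙-no {P = J ⊆ S} (λ J⊆S → S≢J (⊆∧⊄⇒≡ J⊆S J⊄S)) (J ⊆? S)

∈⇒∈elems : ∀ {k} {J : Subset k} {i} → i ∈ J → i ∈ˡ elems J
∈⇒∈elems {k} {J} {i} i∈J = ∈-filter⁺ (_∈? J) (∈-allFin {k} i) i∈J

∈elems⇒∈ : ∀ {k} {J : Subset k} {i} → i ∈ˡ elems J → i ∈ J
∈elems⇒∈ {k} {J} i∈ = proj₂ (∈-filter⁻ (_∈? J) {xs = allFin k} i∈)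

nonempty⇒elems≢[] : ∀ {k} {J : Subset k} → Nonempty J → elems J ≢ []
nonempty⇒elems≢[] (i , i∈J) elems≡[] with subst (i ∈ˡ_) elems≡[] (∈⇒∈elems i∈J)
... | ()

module Levels {k : ℕ} (t : Fin k → ℕ) (t>0 : ∀ i → 0 < t i) {p : ℕ} (pp : Prime p) where

  e : Fin k → ℕ
  e i = proj₁ (val-exists pp (t i) (t>0 i))

  e-val : ∀ i → IsVal p (t i) (e i)
  e-val i = proj₂ (val-exists pp (t i) (t>0 i))

  -- M bounds every exponent, so only the heights m < M matter.
  M : ℕ
  M = sum (map e (allFin k))

  e≤M : ∀ i → e i ≤ M
  e≤M i = ∈⇒≤sum e (∈-allFin i)

  S : ℕ → Subset k
  S m = tabulate (λ i → does (m <? e i))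

  ∈S⇒ : ∀ {m i} → i ∈ S m → m < e i
  ∈S⇒ {m} {i} i∈S = does-true⇒ (m <? e i) (trans (sym (lookup∘tabulate (λ j → does (m <? e j)) i)) ([]=⇒lookup i∈S))

  ⇒∈S : ∀ {m i} → m < e i → i ∈ S m
  ⇒∈S {m} {i} m<e = lookup⇒[]= i (S m) (trans (lookup∘tabulate (λ j → does (m <? e j)) i) (dec-true (m <? e i) m<e))

  S-antitone : ∀ {m m′} → m ≤ m′ → S m′ ⊆ S m
  S-antitone m≤m′ i∈S = ⇒∈S (≤-<-trans m≤m′ (∈S⇒ i∈S))

  #⊆ #⊂ #≡ : Subset k → ℕ
  #⊆ J = count M (λ m → 𝟙 (J ⊆? S m))
  #⊂ J = count M (λ m → 𝟙 (J ⊂? S m))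
  #≡ J = count M (λ m → 𝟙 (S m ≟ₛ J))

  #⊆-split : ∀ J → #⊆ J ≡ #⊂ J + #≡ J
  #⊆-split J = trans (count-cong M (λ m _ → ⊆-split J (S m))) (count-+ M _ _)

  sum-#≡-strictSupersets : ∀ J → sum (map #≡ (strictSupersets J)) ≡ #⊂ J
  sum-#≡-strictSupersets J =
    trans (sum-count M (strictSupersets J) (λ J′ m → 𝟙 (S m ≟ₛ J′)))
          (count-cong M (λ m _ → occ-strictSupersets J (S m)))

  #⊂-full : ∀ J → k ≤ ∣ J ∣ → #⊂ J ≡ 0
  #⊂-full J k≤∣J∣ = trans (count-cong M (λ m _ → 𝟙-no (J⊄S m) (J ⊂? S m))) (count-0 M)
    where
    J⊄S : ∀ m → ¬ J ⊂ S m
    J⊄S m J⊂S = n≮n k (≤-<-trans k≤∣J∣ (<-≤-trans (p⊂q⇒∣p∣<∣q∣ J⊂S) (∣p∣≤n (S m))))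

  minExp : List (Fin k) → ℕ
  minExp []      = M
  minExp (i ∷ l) = e i ⊓ minExp l

  minExp≤M : ∀ l → minExp l ≤ M
  minExp≤M []      = ≤-refl
  minExp≤M (i ∷ l) = ≤-trans (m⊓n≤n (e i) (minExp l)) (minExp≤M l)

  <minExp⇒ : ∀ {m i} l → m < minExp l → i ∈ˡ l → m < e i
  <minExp⇒ (j ∷ l) m< (here refl) = <-≤-trans m< (m⊓n≤m _ _)
  <minExp⇒ (j ∷ l) m< (there i∈l) = <minExp⇒ l (<-≤-trans m< (m⊓n≤n _ _)) i∈l

  ⇒<minExp : ∀ {m} l → m < M → (∀ {i} → i ∈ˡ l → m < e i) → m < minExp l
  ⇒<minExp []      m<M _    = m<M
  ⇒<minExp (j ∷ l) m<M m<e = ⊓-glb (m<e (here refl)) (⇒<minExp l m<M (m<e ∘ there))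

  gcdList-val : ∀ l → l ≢ [] → IsVal p (foldr (λ i g → gcd (t i) g) 0 l) (minExp l)
  gcdList-val []                l≢[] = contradiction refl l≢[]
  gcdList-val (i ∷ [])          _    =
    subst₂ (IsVal p) (sym (gcd-identityʳ (t i))) (sym (m≤n⇒m⊓n≡m (e≤M i))) (e-val i)
  gcdList-val (i ∷ l@(_ ∷ _))   _    = val-gcd pp (e-val i) (gcdList-val l (λ ()))

  minExp≡#⊆ : ∀ J → minExp (elems J) ≡ #⊆ J
  minExp≡#⊆ J = begin
    minExp (elems J)                          ≡⟨ m≥n⇒m⊓n≡n (minExp≤M (elems J)) ⟨
    M ⊓ minExp (elems J)                      ≡⟨ count-< M (minExp (elems J)) ⟨
    count M (λ m → 𝟙 (m <? minExp (elems J))) ≡⟨ count-cong M (λ m m<M → 𝟙-cong below⇒⊆ (⊆⇒below m<M) _ _) ⟩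
    #⊆ J                                      ∎
    where
    open ≡-Reasoning
    below⇒⊆ : ∀ {m} → m < minExp (elems J) → J ⊆ S m
    below⇒⊆ m< i∈J = ⇒∈S (<minExp⇒ (elems J) m< (∈⇒∈elems i∈J))
    ⊆⇒below : ∀ {m} → m < M → J ⊆ S m → m < minExp (elems J)
    ⊆⇒below m<M J⊆S = ⇒<minExp (elems J) m<M (λ i∈ → ∈S⇒ (J⊆S (∈elems⇒∈ i∈)))

  gcdOver-val : ∀ J → Nonempty J → IsVal p (gcdOver t J) (#⊆ J)
  gcdOver-val J neJ = subst (IsVal p (gcdOver t J)) (minExp≡#⊆ J) (gcdList-val (elems J) (nonempty⇒elems≢[] neJ))

module RelativeGcd {k : ℕ} (t : Fin k → ℕ) (t>0 : ∀ i → 0 < t i) where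

  module Lv {p} (pp : Prime p) = Levels t t>0 pp

  HasLevelVal : ℕ → Subset k → Set
  HasLevelVal n J = ∀ {p} (pp : Prime p) → IsVal p n (Lv.#≡ pp J)

  -- The product
  -- has exponent #⊂ J ≤ #⊆ J, the exponent of the gcd, so the division is exact.
  step-val : (x : Subset k → ℕ) (J : Subset k) → Nonempty J →
    (∀ {J′} → J′ ∈ˡ strictSupersets J → HasLevelVal (x J′) J′) →
    HasLevelVal (gcdOver t J div product (map x (strictSupersets J))) J
  step-val x J neJ IH pp =
    subst (IsVal _ _) (m+n∸m≡n (Lv.#⊂ pp J) (Lv.#≡ pp J)) (div-val d>0 g>0 d≤g pp (g-val pp) (d-val pp))
    where
    g d : ℕ
    g = gcdOver t J
    d = product (map x (strictSupersets J))
    g-val : ∀ {p} (pp : Prime p) → IsVal p g (Lv.#⊂ pp J + Lv.#≡ pp J)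
    g-val pp = subst (IsVal _ g) (Lv.#⊆-split pp J) (Lv.gcdOver-val pp J neJ)
    d-val : ∀ {p} (pp : Prime p) → IsVal p d (Lv.#⊂ pp J)
    d-val pp = subst (IsVal _ d) (Lv.sum-#≡-strictSupersets pp J)
                     (val-product pp x (Lv.#≡ pp) (strictSupersets J) (λ J′∈ → IH J′∈ pp))
    d>0 : 0 < d
    d>0 = val⇒pos (d-val prime[2])
    g>0 : 0 < g
    g>0 = val⇒pos (g-val prime[2])
    d≤g : ValLe d g
    d≤g pp d-val′ g-val′ =
      subst₂ _≤_ (val-unique pp (d-val pp) d-val′) (val-unique pp (g-val pp) g-val′) (m≤m+n _ _)

  fuel-step : ∀ {f} {J J′ : Subset k} → J ⊂ J′ → k ∸ ∣ J ∣ ≤ suc f → k ∸ ∣ J′ ∣ ≤ f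
  fuel-step {f} {J} J⊂J′ fuel = ≤-trans (∸-monoʳ-≤ k (p⊂q⇒∣p∣<∣q∣ J⊂J′))
    (subst (_≤ f) (pred[m∸n]≡m∸[1+n] k ∣ J ∣) (pred-mono-≤ fuel))

  relGcdAux-val : ∀ f J → Nonempty J → k ∸ ∣ J ∣ ≤ f → HasLevelVal (relGcdAux t f J) J
  relGcdAux-val zero J neJ fuel pp =
    subst (IsVal _ _) (trans (Lv.#⊆-split pp J) (cong (_+ Lv.#≡ pp J) (Lv.#⊂-full pp J k≤∣J∣)))
          (Lv.gcdOver-val pp J neJ)
    where
    k≤∣J∣ : k ≤ ∣ J ∣
    k≤∣J∣ = m∸n≡0⇒m≤n (n≤0⇒n≡0 fuel)
  relGcdAux-val (suc f) J (i , i∈J) fuel = step-val (relGcdAux t f) J (i , i∈J) IH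
    where
    IH : ∀ {J′} → J′ ∈ˡ strictSupersets J → HasLevelVal (relGcdAux t f J′) J′
    IH J′∈ = let J⊂J′ = ∈-strictSupersets⇒⊂ J′∈
             in relGcdAux-val f _ (i , proj₁ J⊂J′ i∈J) (fuel-step J⊂J′ fuel)

  relGcd-val : ∀ J → Nonempty J → HasLevelVal (relGcd t J) J
  relGcd-val J neJ = relGcdAux-val (k ∸ ∣ J ∣) J neJ ≤-refl

  ∣relGcd⇒level : ∀ {p} (pp : Prime p) J → Nonempty J → p ∣ relGcd t J → ∃ λ m → Lv.S pp m ≡ J
  ∣relGcd⇒level pp J neJ p∣x with count-pos (Lv.M pp) _ (∣⇒1≤val pp p∣x (relGcd-val J neJ pp))
  ... | m , _ , 1≤𝟙 = m , 𝟙-pos (Lv.S pp m ≟ₛ J) 1≤𝟙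

  -- Level sets are nested, so incomparable J, K share no prime factor of x_J, x_K.
  incomparable⇒noCommonPrime : ∀ J K → Nonempty J → Nonempty K → ¬ J ⊆ K → ¬ K ⊆ J →
    ∀ {p} → Prime p → p ∣ relGcd t J → p ∣ relGcd t K → ⊥
  incomparable⇒noCommonPrime J K neJ neK J⊈K K⊈J pp p∣xJ p∣xK
    with ∣relGcd⇒level pp J neJ p∣xJ | ∣relGcd⇒level pp K neK p∣xK
  ... | m , refl | m′ , refl with ≤-total m m′
  ... | inj₁ m≤m′ = K⊈J (Lv.S-antitone pp m≤m′)
  ... | inj₂ m′≤m = J⊈K (Lv.S-antitone pp m′≤m)

-- Incomparable J, K have no common prime in x_J, x_K and x_J > 0, so
-- gcd(x_J, x_K) = 1.
lemma4p1 : (k : ℕ) → 1 ≤ k → (t : Fin k → ℕ) → (∀ i → NonZero (t i)) →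
    (J K : Subset k) → Nonempty J → Nonempty K → ¬ (J ⊆ K) → ¬ (K ⊆ J) →
    gcd (relGcd t J) (relGcd t K) ≡ 1
lemma4p1 k _ t t≢0 J K neJ neK J⊈K K⊈J =
  coprime⇒gcd≡1 (noCommonPrime⇒coprime xJ>0 (incomparable⇒noCommonPrime J K neJ neK J⊈K K⊈J))
  where
  open RelativeGcd t (λ i → >-nonZero⁻¹ (t i) {{t≢0 i}})
  xJ>0 : 0 < relGcd t J
  xJ>0 = val⇒pos (relGcd-val J neJ prime[2])
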